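{- $\gamma^{L\text{ - }LD}(\mathcal{S})=\frac{1}{5}$ and $\gamma^{L\text{ - }LD}(\mathcal{H})=\frac{1}{4}$.
   Context: The square grid $\mathcal{S}$ has vertex set $\mathbb{Z}^2$, with $\mathbf{u},\mathbf{v}$ adjacent iff $\mathbf{u}-\mathbf{v}\in\{(\pm1,0),(0,\pm1)\}$. The hexagonal grid $\mathcal{H}$ has vertex set $\mathbb{Z}^2$, with $\mathbf{u}=(i,j)$ and $\mathbf{v}$ adjacent iff $\mathbf{u}-\mathbf{v}\in\{(\pm1,0),(0,(-1)^{i+j+1})\}$. For a vertex $u$, $N[u]$ is its closed neighbourhood; for a code (nonempty vertex subset) $C$, $I_C(u)=N[u]\cap C$. $C$ is a covering code if $I_C(u)\neq\emptyset$ for all $u$, and a local locating-dominating code if it is covering and $I_C(u)\neq I_C(v)$ for all adjacent $u,v\notin C$. The density of $C\subseteq\mathbb{Z}^2$ is $D(C)=\limsup_{n\to\infty}\frac{|C\cap Q_n|}{|Q_n|}$ with $Q_n=\{(i,j)\in\mathbb{Z}^2: |i|\leq n,|j|\leq n\}$. $\gamma^{L\text{ - }LD}(G)$ is the smallest density of a local locating-dominating code in the grid $G$. -}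

module Defs where

open import Data.Nat as ℕ using (ℕ; suc)
open import Data.Nat.DivMod using (_%_)
open import Data.Integer as ℤ using (ℤ; +_; -[1+_]; ∣_∣)
open import Data.Rational as ℚ using (ℚ; _/_)
open import Data.Bool using (Bool; true; false; if_then_else_)
open import Data.List using (List; map; upTo; concatMap)
open import Data.Nat.ListAction using (sum)
open import Data.Product using (_×_; Σ; ∃; ∃-syntax; _,_)
open import Data.Sum using (_⊎_)
open import Relation.Nullary using (¬_)
open import Relation.Binary.PropositionalEquality using (_≡_)

V : Set
V = ℤ × ℤ

Code : Set
Code = V → Bool

Grid : Set₁
Grid = V → V → Set

Unit± : ℤ → Set
Unit± d = (d ≡ + 1) ⊎ (d ≡ -[1+ 0 ])

SqAdj : Grid
SqAdj (i , j) (i' , j') =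
  (Unit± (i ℤ.- i') × (j ℤ.- j' ≡ + 0)) ⊎ ((i ℤ.- i' ≡ + 0) × Unit± (j ℤ.- j'))

-- (-1)^(i+j+1) : equals -1 if i+j is even, +1 if i+j is odd.
hexSign : ℤ → ℤ → ℤ
hexSign i j with ∣ i ℤ.+ j ∣ % 2
... | 0 = -[1+ 0 ]
... | _ = + 1

HexAdj : Grid
HexAdj (i , j) (i' , j') =
  (Unit± (i ℤ.- i') × (j ℤ.- j' ≡ + 0)) ⊎ ((i ℤ.- i' ≡ + 0) × (j ℤ.- j' ≡ hexSign i j))

N[_]∋_ : Grid → V → V → Set
(N[ G ]∋ u) w = (w ≡ u) ⊎ G u w

I∋ : Grid → Code → V → V → Set
I∋ G C u w = (N[ G ]∋ u) w × (C w ≡ true)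

IsCovering : Grid → Code → Set
IsCovering G C = ∀ u → ∃[ w ] I∋ G C u w

IsLLD : Grid → Code → Set
IsLLD G C = IsCovering G C ×
  (∀ u v → G u v → C u ≡ false → C v ≡ false →
     ¬ (∀ w → (I∋ G C u w → I∋ G C v w) × (I∋ G C v w → I∋ G C u w)))

range : ℕ → List ℤ
range n = map (λ k → + k ℤ.- + n) (upTo (suc (2 ℕ.* n)))

b2n : Bool → ℕ
b2n b = if b then 1 else 0

count : Code → ℕ → ℕ
count C n = sum (concatMap (λ i → map (λ j → b2n (C (i , j))) (range n)) (range n))

ratio : Code → ℕ → ℚ
ratio C n = (+ count C n) / (suc (2 ℕ.* n) ℕ.* suc (2 ℕ.* n))

-- limsup of a sequence of rationals (bounded) equals q, expressed via rationals:
-- limsup a ≤ q  :  ∀ ε > 0, eventually a n ≤ q + ε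
-- q ≤ limsup a  :  ∀ ε > 0, ∀ N, ∃ n ≥ N, q - ε < a n
LimsupLe : (ℕ → ℚ) → ℚ → Set
LimsupLe a q = ∀ (ε : ℚ) → ℚ.0ℚ ℚ.< ε → ∃[ N ] (∀ n → N ℕ.≤ n → a n ℚ.≤ q ℚ.+ ε)

LimsupGe : (ℕ → ℚ) → ℚ → Set
LimsupGe a q = ∀ (ε : ℚ) → ℚ.0ℚ ℚ.< ε → ∀ N → ∃[ n ] (N ℕ.≤ n × q ℚ.- ε ℚ.< a n)

DensityEq : Code → ℚ → Set
DensityEq C q = LimsupLe (ratio C) q × LimsupGe (ratio C) q

DensityGe : Code → ℚ → Set
DensityGe C q = LimsupGe (ratio C) q

GammaLLD≡ : Grid → ℚ → Set
GammaLLD≡ G q = (∃[ C ] (IsLLD G C × DensityEq C q)) × (∀ C → IsLLD G C → DensityGe C q)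

{-# OPTIONS --safe #-}
module Submission where

-- Both grids are bipartite (every edge changes i + j by ±1), so two adjacent
-- non-codewords never share a codeword neighbour: every covering code is already
-- local locating-dominating, and γ^{L-LD} is the least density of a covering code.
-- A closed neighbourhood N[u] is the image of u under k bijections of ℤ² (k = 5 on
-- the square grid, k = 4 on the hexagonal one), each mapping Q_n into Q_{n+1}.
-- Summing |N[u] ∩ C| ≥ 1 over u ∈ Q_n gives |Q_n| ≤ k |C ∩ Q_{n+1}|, so D(C) ≥ 1/k.
-- The codes i + 2j ≡ 0 (mod 5) and i + 2j ≡ 0 (mod 4) meet every closed
-- neighbourhood exactly once, and the same count gives k |C ∩ Q_n| ≤ |Q_{n+1}|,
-- so their density is exactly 1/k. On the hexagonal grid the vertical neighbour
-- map swaps consecutive vertices of a column in pairs.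

open import Defs

open import Algebra.Properties.CommutativeSemigroup using (interchange; x∙yz≈y∙xz; xy∙z≈xz∙y)
open import Data.Bool using (Bool; true; false)
open import Data.Empty using (⊥)
open import Data.Fin as Fin using (Fin; zero; suc; toℕ)
open import Data.Fin.Properties using (toℕ-injective; toℕ-fromℕ<; toℕ<n; all?)
open import Data.Integer as ℤ using (ℤ; +_; +[1+_]; -[1+_]; +0; ∣_∣; 0ℤ; 1ℤ; -1ℤ)
import Data.Integer.Properties as ℤ
import Data.Integer.Tactic.RingSolver as ℤ-Ring
open import Data.List using (List; []; _∷_; length; map; upTo; applyUpTo; concatMap)
open import Data.List.Membership.Propositional using (_∈_; lose; find)
open import Data.List.Properties using (map-applyUpTo; map-cong; map-∘)
open import Data.List.Relation.Unary.Any using (Any; here; there)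
open import Data.Nat as ℕ using (ℕ; zero; suc; _+_; _*_; _≤_; _<_; z≤n; s≤s)
open import Data.Nat.DivMod using (_%_; _mod_; [m+n]%n≡m%n; %-distribˡ-+; m%n%n≡m%n; m<n⇒m%n≡m)
open import Data.Nat.ListAction using (sum)
open import Data.Nat.ListAction.Properties using (sum-++)
import Data.Nat.Properties as ℕ
import Data.Nat.Tactic.RingSolver as ℕ-Ring
open import Data.Product using (_×_; _,_; proj₁; proj₂)
open import Data.Rational as ℚ using (mkℚ; _/_; toℚᵘ)
open import Data.Rational.Properties using (toℚᵘ-fromℚᵘ; toℚᵘ-homo-+; toℚᵘ-cancel-≤; toℚᵘ-cancel-<)
open import Data.Rational.Unnormalised as ℚᵘ using (mkℚᵘ)
  renaming (_≃_ to _≃ᵘ_; _≤_ to _≤ᵘ_; _<_ to _<ᵘ_)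
import Data.Rational.Unnormalised.Properties as ℚᵘ
open import Data.Sum using (_⊎_; inj₁; inj₂)
open import Function using (_∘_)
open import Function.Bundles using (_⇔_; mk⇔; Equivalence)
open import Relation.Binary.PropositionalEquality
open import Relation.Nullary using (¬_)
open import Relation.Nullary.Decidable using (from-yes)

+-−-cancel : ∀ a c → (a ℤ.+ c) ℤ.- c ≡ a
+-−-cancel = ℤ-Ring.solve-∀

−-+-cancel : ∀ a c → (a ℤ.- c) ℤ.+ c ≡ a
−-+-cancel = ℤ-Ring.solve-∀

−-−-cancel : ∀ a c → a ℤ.- (a ℤ.- c) ≡ c
−-−-cancel = ℤ-Ring.solve-∀

diff-shift : ∀ x a → x ℤ.- (x ℤ.+ a) ≡ ℤ.- a
diff-shift = ℤ-Ring.solve-∀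

solve-diff : ∀ x x′ {c} → x ℤ.- x′ ≡ c → x′ ≡ x ℤ.- c
solve-diff x x′ refl = sym (−-−-cancel x x′)

-- Sums over integer intervals

sumFrom : ℤ → ℕ → (ℤ → ℕ) → ℕ
sumFrom a zero    f = 0
sumFrom a (suc L) f = f a + sumFrom (a ℤ.+ 1ℤ) L f

module _ {f g : ℤ → ℕ} where

  sumFrom-cong : ∀ a L → (∀ x → f x ≡ g x) → sumFrom a L f ≡ sumFrom a L g
  sumFrom-cong a zero    f≗g = refl
  sumFrom-cong a (suc L) f≗g = cong₂ _+_ (f≗g a) (sumFrom-cong (a ℤ.+ 1ℤ) L f≗g)

  sumFrom-mono : ∀ a L → (∀ x → f x ≤ g x) → sumFrom a L f ≤ sumFrom a L g
  sumFrom-mono a zero    f≤g = z≤n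
  sumFrom-mono a (suc L) f≤g = ℕ.+-mono-≤ (f≤g a) (sumFrom-mono (a ℤ.+ 1ℤ) L f≤g)

sumFrom-+ : ∀ a L (f g : ℤ → ℕ) → sumFrom a L (λ x → f x + g x) ≡ sumFrom a L f + sumFrom a L g
sumFrom-+ a zero    f g = refl
sumFrom-+ a (suc L) f g = begin
  (f a + g a) + sumFrom (a ℤ.+ 1ℤ) L (λ x → f x + g x)
    ≡⟨ cong (_+_ (f a + g a)) (sumFrom-+ (a ℤ.+ 1ℤ) L f g) ⟩
  (f a + g a) + (sumFrom (a ℤ.+ 1ℤ) L f + sumFrom (a ℤ.+ 1ℤ) L g)
    ≡⟨ interchange ℕ.+-commutativeSemigroup (f a) (g a) _ _ ⟩
  (f a + sumFrom (a ℤ.+ 1ℤ) L f) + (g a + sumFrom (a ℤ.+ 1ℤ) L g) ∎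
  where open ≡-Reasoning

sumFrom-const : ∀ a L k → sumFrom a L (λ _ → k) ≡ L * k
sumFrom-const a zero    k = refl
sumFrom-const a (suc L) k = cong (_+_ k) (sumFrom-const (a ℤ.+ 1ℤ) L k)

sumFrom-extendʳ : ∀ a L f → sumFrom a L f ≤ sumFrom a (suc L) f
sumFrom-extendʳ a zero    f = z≤n
sumFrom-extendʳ a (suc L) f = ℕ.+-monoʳ-≤ (f a) (sumFrom-extendʳ (a ℤ.+ 1ℤ) L f)

sumFrom-extendˡ : ∀ a L f → sumFrom (a ℤ.+ 1ℤ) L f ≤ sumFrom a (suc L) f
sumFrom-extendˡ a L f = ℕ.m≤n+m _ (f a)

sumFrom-shift : ∀ c a L f → sumFrom a L (f ∘ (ℤ._+ c)) ≡ sumFrom (a ℤ.+ c) L f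
sumFrom-shift c a zero    f = refl
sumFrom-shift c a (suc L) f = cong (_+_ (f (a ℤ.+ c))) (begin
  sumFrom (a ℤ.+ 1ℤ) L (f ∘ (ℤ._+ c))
    ≡⟨ sumFrom-shift c (a ℤ.+ 1ℤ) L f ⟩
  sumFrom ((a ℤ.+ 1ℤ) ℤ.+ c) L f
    ≡⟨ cong (λ b → sumFrom b L f) (xy∙z≈xz∙y ℤ.+-commutativeSemigroup a 1ℤ c) ⟩
  sumFrom ((a ℤ.+ c) ℤ.+ 1ℤ) L f ∎)
  where open ≡-Reasoning

sum-map-applyUpTo : ∀ (h : ℕ → ℤ) L f → (∀ k → h (suc k) ≡ h k ℤ.+ 1ℤ) →
                    sum (map f (applyUpTo h L)) ≡ sumFrom (h 0) L f
sum-map-applyUpTo h zero    f step = refl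
sum-map-applyUpTo h (suc L) f step = cong (_+_ (f (h 0))) (begin
  sum (map f (applyUpTo (h ∘ suc) L)) ≡⟨ sum-map-applyUpTo (h ∘ suc) L f (step ∘ suc) ⟩
  sumFrom (h 1) L f                   ≡⟨ cong (λ b → sumFrom b L f) (step 0) ⟩
  sumFrom (h 0 ℤ.+ 1ℤ) L f            ∎)
  where open ≡-Reasoning

sum-concatMap : ∀ {A : Set} (f : A → List ℕ) xs → sum (concatMap f xs) ≡ sum (map (sum ∘ f) xs)
sum-concatMap f []       = refl
sum-concatMap f (x ∷ xs) =
  trans (sum-++ (f x) (concatMap f xs)) (cong (_+_ (sum (f x))) (sum-concatMap f xs))

lo : ℕ → ℤ
lo n = ℤ.- (+ n)

width : ℕ → ℕ
width n = suc (2 * n)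

lo-suc : ∀ n → lo (suc n) ℤ.+ 1ℤ ≡ lo n
lo-suc n = trans (ℤ.+-comm (lo (suc n)) 1ℤ) (ℤ.1-[1+n]≡-n n)

width-suc : ∀ n → width (suc n) ≡ suc (suc (width n))
width-suc n = cong suc (ℕ.*-suc 2 n)

centredSum : ℕ → (ℤ → ℕ) → ℕ
centredSum n f = sumFrom (lo n) (width n) f

-- Stated through sums: φ maps [-n, n] injectively into [-(n + 1), n + 1].
Widens : (ℤ → ℤ) → Set
Widens φ = ∀ n f → centredSum n (f ∘ φ) ≤ centredSum (suc n) f

widens-by-window : ∀ {φ} → (∀ b L f → sumFrom (b ℤ.+ 1ℤ) L (f ∘ φ) ≤ sumFrom b (suc (suc L)) f) →
                   Widens φ
widens-by-window {φ} window n f = begin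
  centredSum n (f ∘ φ)
    ≡⟨ cong (λ b → sumFrom b (width n) (f ∘ φ)) (lo-suc n) ⟨
  sumFrom (lo (suc n) ℤ.+ 1ℤ) (width n) (f ∘ φ)
    ≤⟨ window (lo (suc n)) (width n) f ⟩
  sumFrom (lo (suc n)) (suc (suc (width n))) f
    ≡⟨ cong (λ L → sumFrom (lo (suc n)) L f) (width-suc n) ⟨
  centredSum (suc n) f ∎
  where open ℕ.≤-Reasoning

Small : ℤ → Set
Small c = (c ≡ 0ℤ) ⊎ Unit± c

Small-neg : ∀ {c} → Small c → Small (ℤ.- c)
Small-neg (inj₁ refl)        = inj₁ refl
Small-neg (inj₂ (inj₁ refl)) = inj₂ (inj₂ refl)
Small-neg (inj₂ (inj₂ refl)) = inj₂ (inj₁ refl)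

sumFrom-window : ∀ {c} → Small c → ∀ b L f →
                 sumFrom ((b ℤ.+ 1ℤ) ℤ.+ c) L f ≤ sumFrom b (suc (suc L)) f
sumFrom-window (inj₁ refl) b L f rewrite ℤ.+-identityʳ (b ℤ.+ 1ℤ) =
  ℕ.≤-trans (sumFrom-extendˡ b L f) (sumFrom-extendʳ b (suc L) f)
sumFrom-window (inj₂ (inj₁ refl)) b L f =
  ℕ.≤-trans (sumFrom-extendˡ (b ℤ.+ 1ℤ) L f) (sumFrom-extendˡ b (suc L) f)
sumFrom-window (inj₂ (inj₂ refl)) b L f rewrite +-−-cancel b 1ℤ =
  ℕ.≤-trans (sumFrom-extendʳ b L f) (sumFrom-extendʳ b (suc L) f)

widens-+ : ∀ {c} → Small c → Widens (ℤ._+ c)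
widens-+ {c} small = widens-by-window λ b L f →
  subst (_≤ sumFrom b (suc (suc L)) f) (sym (sumFrom-shift c (b ℤ.+ 1ℤ) L f))
        (sumFrom-window small b L f)

widens-id : Widens (λ x → x)
widens-id n f = subst (_≤ centredSum (suc n) f)
  (sumFrom-cong (lo n) (width n) (λ x → cong f (ℤ.+-identityʳ x)))
  (widens-+ (inj₁ refl) n f)

module Partner (s : ℤ → ℤ) (s-unit : ∀ a → Unit± (s a))
               (s-alternates : ∀ a → s (a ℤ.+ 1ℤ) ≡ ℤ.- s a) where

  partner : ℤ → ℤ
  partner a = a ℤ.- s a

  private
    partner-up : ∀ {a} → s a ≡ -1ℤ → partner a ≡ a ℤ.+ 1ℤ
    partner-up {a} e = cong (λ t → a ℤ.- t) e

    partner-down : ∀ {a} → s a ≡ 1ℤ → partner a ≡ a ℤ.- 1ℤ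
    partner-down {a} e = cong (λ t → a ℤ.- t) e

    flips-up : ∀ {a} → s a ≡ -1ℤ → s (a ℤ.+ 1ℤ) ≡ 1ℤ
    flips-up {a} e = trans (s-alternates a) (cong ℤ.-_ e)

    flips-down : ∀ {a} → s a ≡ 1ℤ → s (a ℤ.+ 1ℤ) ≡ -1ℤ
    flips-down {a} e = trans (s-alternates a) (cong ℤ.-_ e)

    flips-back : ∀ a → s (a ℤ.- 1ℤ) ≡ ℤ.- s a
    flips-back a = begin
      s (a ℤ.- 1ℤ)                 ≡⟨ ℤ.neg-involutive _ ⟨
      ℤ.- ℤ.- s (a ℤ.- 1ℤ)         ≡⟨ cong ℤ.-_ (s-alternates (a ℤ.- 1ℤ)) ⟨
      ℤ.- s ((a ℤ.- 1ℤ) ℤ.+ 1ℤ)    ≡⟨ cong (ℤ.-_ ∘ s) (−-+-cancel a 1ℤ) ⟩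
      ℤ.- s a                      ∎
      where open ≡-Reasoning

  partner-involutive : ∀ a → partner (partner a) ≡ a
  partner-involutive a with s-unit a
  ... | inj₁ e rewrite e | flips-back a | e = −-+-cancel a 1ℤ
  ... | inj₂ e rewrite e | s-alternates a | e = +-−-cancel a 1ℤ

  -- When s a = -1 the pair {a, a + 1} is closed under partner.
  sumFrom-partner-paired : ∀ a L f → s a ≡ -1ℤ → sumFrom a L (f ∘ partner) ≤ sumFrom a (suc L) f
  sumFrom-partner-paired a zero          f e = z≤n
  sumFrom-partner-paired a (suc zero)    f e rewrite partner-up e = ℕ.m≤n+m _ (f a)
  sumFrom-partner-paired a (suc (suc L)) f e
    rewrite partner-up e | partner-down (flips-up e) | +-−-cancel a 1ℤ = begin
      f a′ + (f a + sumFrom a″ L (f ∘ partner))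
        ≡⟨ x∙yz≈y∙xz ℕ.+-commutativeSemigroup (f a′) (f a) _ ⟩
      f a + (f a′ + sumFrom a″ L (f ∘ partner))
        ≤⟨ ℕ.+-monoʳ-≤ (f a) (ℕ.+-monoʳ-≤ (f a′) rest) ⟩
      f a + (f a′ + sumFrom a″ (suc L) f) ∎
    where
    open ℕ.≤-Reasoning
    a′ = a ℤ.+ 1ℤ
    a″ = a′ ℤ.+ 1ℤ
    rest : sumFrom a″ L (f ∘ partner) ≤ sumFrom a″ (suc L) f
    rest = sumFrom-partner-paired a″ L f (flips-down (flips-up e))

  widens-partner : Widens partner
  widens-partner = widens-by-window window
    where
    window : ∀ b L f → sumFrom (b ℤ.+ 1ℤ) L (f ∘ partner) ≤ sumFrom b (suc (suc L)) f
    window b L f with s-unit (b ℤ.+ 1ℤ)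
    ... | inj₂ e =
      ℕ.≤-trans (sumFrom-partner-paired (b ℤ.+ 1ℤ) L f e) (sumFrom-extendˡ b (suc L) f)
    window b zero    f | inj₁ e = z≤n
    window b (suc L) f | inj₁ e rewrite partner-down e | +-−-cancel b 1ℤ =
      ℕ.+-monoʳ-≤ (f b) (ℕ.≤-trans (sumFrom-partner-paired _ L f (flips-down e))
                                   (sumFrom-extendˡ (b ℤ.+ 1ℤ) (suc L) f))

-- Boxes, neighbour maps and counting

boxSum : ℕ → (V → ℕ) → ℕ
boxSum n F = centredSum n (λ i → centredSum n (λ j → F (i , j)))

module _ (n : ℕ) where

  boxSum-cong : ∀ {F G : V → ℕ} → (∀ u → F u ≡ G u) → boxSum n F ≡ boxSum n G
  boxSum-cong F≗G =
    sumFrom-cong (lo n) (width n) (λ i → sumFrom-cong (lo n) (width n) (λ j → F≗G (i , j)))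

  boxSum-mono : ∀ {F G : V → ℕ} → (∀ u → F u ≤ G u) → boxSum n F ≤ boxSum n G
  boxSum-mono F≤G =
    sumFrom-mono (lo n) (width n) (λ i → sumFrom-mono (lo n) (width n) (λ j → F≤G (i , j)))

  boxSum-+ : ∀ (F G : V → ℕ) → boxSum n (λ u → F u + G u) ≡ boxSum n F + boxSum n G
  boxSum-+ F G = trans
    (sumFrom-cong (lo n) (width n) (λ i → sumFrom-+ (lo n) (width n) (λ j → F (i , j)) (λ j → G (i , j))))
    (sumFrom-+ (lo n) (width n) (λ i → centredSum n (λ j → F (i , j))) (λ i → centredSum n (λ j → G (i , j))))

  boxSum-const : ∀ k → boxSum n (λ _ → k) ≡ width n * (width n * k)
  boxSum-const k = trans (sumFrom-cong (lo n) (width n) (λ _ → sumFrom-const (lo n) (width n) k))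
                         (sumFrom-const (lo n) (width n) (width n * k))

  boxSum-sum : ∀ {A : Set} (F : A → V → ℕ) xs →
               boxSum n (λ u → sum (map (λ x → F x u) xs)) ≡ sum (map (λ x → boxSum n (F x)) xs)
  boxSum-sum F []       =
    trans (boxSum-const 0) (trans (cong (width n *_) (ℕ.*-zeroʳ (width n))) (ℕ.*-zeroʳ (width n)))
  boxSum-sum F (x ∷ xs) = trans (boxSum-+ (F x) _) (cong (_+_ (boxSum n (F x))) (boxSum-sum F xs))

Expands : (V → V) → Set
Expands ν = ∀ n F → boxSum n (F ∘ ν) ≤ boxSum (suc n) F

expands : ∀ {ρ : ℤ → ℤ} {ψ : ℤ → ℤ → ℤ} → Widens ρ → (∀ i → Widens (ψ i)) →
          Expands (λ (i , j) → ρ i , ψ i j)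
expands {ρ} {ψ} ρ-widens ψ-widens n F = begin
  centredSum n (λ i → centredSum n (λ j → F (ρ i , ψ i j)))
    ≤⟨ sumFrom-mono (lo n) (width n) (λ i → ψ-widens i n (λ j → F (ρ i , j))) ⟩
  centredSum n (λ i → centredSum (suc n) (λ j → F (ρ i , j)))
    ≤⟨ ρ-widens n (λ i → centredSum (suc n) (λ j → F (i , j))) ⟩
  boxSum (suc n) F ∎
  where open ℕ.≤-Reasoning

sum-range : ∀ n f → sum (map f (range n)) ≡ centredSum n f
sum-range n f = begin
  sum (map f (map h (upTo (width n))))  ≡⟨ cong (sum ∘ map f) (map-applyUpTo (λ k → k) h (width n)) ⟩
  sum (map f (applyUpTo h (width n)))   ≡⟨ sum-map-applyUpTo h (width n) f step ⟩
  sumFrom (h 0) (width n) f             ≡⟨ cong (λ b → sumFrom b (width n) f) (ℤ.+-identityˡ (lo n)) ⟩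
  centredSum n f                        ∎
  where
  open ≡-Reasoning
  h : ℕ → ℤ
  h k = + k ℤ.- + n
  step : ∀ k → h (suc k) ≡ h k ℤ.+ 1ℤ
  step k = trans (ℤ.suc-+ k (lo n)) (ℤ.+-comm 1ℤ (h k))

count≡boxSum : ∀ C n → count C n ≡ boxSum n (b2n ∘ C)
count≡boxSum C n = begin
  count C n
    ≡⟨ sum-concatMap (λ i → map (λ j → b2n (C (i , j))) (range n)) (range n) ⟩
  sum (map (λ i → sum (map (λ j → b2n (C (i , j))) (range n))) (range n))
    ≡⟨ cong sum (map-cong (λ i → sum-range n (λ j → b2n (C (i , j)))) (range n)) ⟩
  sum (map (λ i → centredSum n (λ j → b2n (C (i , j)))) (range n))
    ≡⟨ sum-range n _ ⟩
  boxSum n (b2n ∘ C) ∎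
  where open ≡-Reasoning

boxSize : ℕ → ℕ
boxSize n = width n * width n

boxSum-one : ∀ n → boxSum n (λ _ → 1) ≡ boxSize n
boxSum-one n = trans (boxSum-const n 1) (cong (width n *_) (ℕ.*-identityʳ (width n)))

sum-map-≤ : ∀ {A : Set} {f : A → ℕ} {k} xs → (∀ x → f x ≤ k) → sum (map f xs) ≤ length xs * k
sum-map-≤ []       f≤k = z≤n
sum-map-≤ (x ∷ xs) f≤k = ℕ.+-mono-≤ (f≤k x) (sum-map-≤ xs f≤k)

sum-map-≥ : ∀ {A : Set} {f : A → ℕ} {k} xs → (∀ x → k ≤ f x) → length xs * k ≤ sum (map f xs)
sum-map-≥ []       k≤f = z≤n
sum-map-≥ (x ∷ xs) k≤f = ℕ.+-mono-≤ (k≤f x) (sum-map-≥ xs k≤f)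

record Move : Set where
  field
    to           : V → V
    from         : V → V
    to-from      : ∀ u → to (from u) ≡ u
    to-expands   : Expands to
    from-expands : Expands from

  to-covers : ∀ n F → boxSum n F ≤ boxSum (suc n) (F ∘ to)
  to-covers n F = subst (_≤ boxSum (suc n) (F ∘ to))
    (boxSum-cong n (λ u → cong F (to-from u))) (from-expands n (F ∘ to))

open Move

neighbours : List Move → V → List V
neighbours ms u = map (λ m → to m u) ms

hits : Code → List Move → V → ℕ
hits C ms u = sum (map (b2n ∘ C) (neighbours ms u))

boxSum-hits : ∀ C ms n → boxSum n (hits C ms) ≡ sum (map (λ m → boxSum n (b2n ∘ C ∘ to m)) ms)
boxSum-hits C ms n =
  trans (boxSum-cong n (λ u → cong sum (sym (map-∘ ms)))) (boxSum-sum n (λ m → b2n ∘ C ∘ to m) ms)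

covering-bound : ∀ C ms → (∀ u → 1 ≤ hits C ms u) → ∀ n → boxSize n ≤ length ms * count C (suc n)
covering-bound C ms hit n = begin
  boxSize n                                       ≡⟨ boxSum-one n ⟨
  boxSum n (λ _ → 1)                              ≤⟨ boxSum-mono n hit ⟩
  boxSum n (hits C ms)                            ≡⟨ boxSum-hits C ms n ⟩
  sum (map (λ m → boxSum n (b2n ∘ C ∘ to m)) ms)  ≤⟨ sum-map-≤ ms (λ m → to-expands m n (b2n ∘ C)) ⟩
  length ms * boxSum (suc n) (b2n ∘ C)            ≡⟨ cong (length ms *_) (count≡boxSum C (suc n)) ⟨
  length ms * count C (suc n)                     ∎
  where open ℕ.≤-Reasoning

perfect-bound : ∀ C ms → (∀ u → hits C ms u ≡ 1) → ∀ n → length ms * count C n ≤ boxSize (suc n)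
perfect-bound C ms hit n = begin
  length ms * count C n                                 ≡⟨ cong (length ms *_) (count≡boxSum C n) ⟩
  length ms * boxSum n (b2n ∘ C)                        ≤⟨ sum-map-≥ ms (λ m → to-covers m n (b2n ∘ C)) ⟩
  sum (map (λ m → boxSum (suc n) (b2n ∘ C ∘ to m)) ms)  ≡⟨ boxSum-hits C ms (suc n) ⟨
  boxSum (suc n) (hits C ms)                            ≡⟨ boxSum-cong (suc n) hit ⟩
  boxSum (suc n) (λ _ → 1)                              ≡⟨ boxSum-one (suc n) ⟩
  boxSize (suc n)                                       ∎
  where open ℕ.≤-Reasoning

any⇒1≤sum : ∀ {A : Set} (p : A → Bool) {xs} → Any (λ x → p x ≡ true) xs →
            1 ≤ sum (map (b2n ∘ p) xs)
any⇒1≤sum p (here px) rewrite px = s≤s z≤n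
any⇒1≤sum p {x ∷ _} (there any) = ℕ.≤-trans (any⇒1≤sum p any) (ℕ.m≤n+m _ (b2n (p x)))

1≤sum⇒any : ∀ {A : Set} (p : A → Bool) xs → 1 ≤ sum (map (b2n ∘ p) xs) →
            Any (λ x → p x ≡ true) xs
1≤sum⇒any p (x ∷ xs) pos with p x in px
... | true  = here px
... | false = there (1≤sum⇒any p xs pos)

record Describes (G : Grid) (ms : List Move) : Set where
  field
    closed-neighbourhood : ∀ u w → (N[ G ]∋ u) w ⇔ w ∈ neighbours ms u

open Describes

module _ {G : Grid} {ms : List Move} (G≅ms : Describes G ms) (C : Code) where

  covering⇒hits : IsCovering G C → ∀ u → 1 ≤ hits C ms u
  covering⇒hits cov u with cov u
  ... | w , u∋w , Cw =
    any⇒1≤sum C (lose (Equivalence.to (closed-neighbourhood G≅ms u w) u∋w) Cw)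

  hits⇒covering : (∀ u → 1 ≤ hits C ms u) → IsCovering G C
  hits⇒covering hit u with find (1≤sum⇒any C (neighbours ms u) (hit u))
  ... | w , w∈ , Cw = w , Equivalence.from (closed-neighbourhood G≅ms u w) w∈ , Cw

Δ : V → V → ℤ
Δ (i , j) (i′ , j′) = (i ℤ.- i′) ℤ.+ (j ℤ.- j′)

Δ-trans : ∀ u v w → Δ u w ≡ Δ u v ℤ.+ Δ v w
Δ-trans (a , b) (c , d) (e , f) = telescope a b c d e f
  where
  telescope : ∀ a b c d e f →
              (a ℤ.- e) ℤ.+ (b ℤ.- f) ≡ ((a ℤ.- c) ℤ.+ (b ℤ.- d)) ℤ.+ ((c ℤ.- e) ℤ.+ (d ℤ.- f))
  telescope = ℤ-Ring.solve-∀

Bipartite : Grid → Set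
Bipartite G = ∀ u v → G u v → Unit± (Δ u v)

unit+unit-not-unit : ∀ {a b} → Unit± a → Unit± b → ¬ Unit± (a ℤ.+ b)
unit+unit-not-unit (inj₁ refl) (inj₁ refl) (inj₁ ())
unit+unit-not-unit (inj₁ refl) (inj₁ refl) (inj₂ ())
unit+unit-not-unit (inj₁ refl) (inj₂ refl) (inj₁ ())
unit+unit-not-unit (inj₁ refl) (inj₂ refl) (inj₂ ())
unit+unit-not-unit (inj₂ refl) (inj₁ refl) (inj₁ ())
unit+unit-not-unit (inj₂ refl) (inj₁ refl) (inj₂ ())
unit+unit-not-unit (inj₂ refl) (inj₂ refl) (inj₁ ())
unit+unit-not-unit (inj₂ refl) (inj₂ refl) (inj₂ ())

bipartite⇒no-triangle : ∀ {G} → Bipartite G → ∀ {u v w} → G u v → G v w → ¬ G u w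
bipartite⇒no-triangle bip {u} {v} {w} uv vw uw =
  unit+unit-not-unit (bip u v uv) (bip v w vw) (subst Unit± (Δ-trans u v w) (bip u w uw))

-- A common codeword of two adjacent non-codewords would close a triangle.
bipartite-covering⇒LLD : ∀ {G C} → Bipartite G → IsCovering G C → IsLLD G C
bipartite-covering⇒LLD {G} {C} bip cov = cov , separated
  where
  clash : ∀ {x} → C x ≡ true → C x ≡ false → ⊥
  clash t f with trans (sym t) f
  ... | ()

  separated : ∀ u v → G u v → C u ≡ false → C v ≡ false →
              ¬ (∀ w → (I∋ G C u w → I∋ G C v w) × (I∋ G C v w → I∋ G C u w))
  separated u v uv Cu Cv same with cov u
  ... | _ , inj₁ refl , Cw = clash Cw Cu
  ... | w , inj₂ uw , Cw with proj₁ (same w) (inj₂ uw , Cw)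
  ...   | inj₁ refl , _ = clash Cw Cv
  ...   | inj₂ vw , _  = bipartite⇒no-triangle bip uv vw uw

unit+zero : ∀ {a b} → Unit± a → b ≡ 0ℤ → Unit± (a ℤ.+ b)
unit+zero {a} ua refl = subst Unit± (sym (ℤ.+-identityʳ a)) ua

zero+unit : ∀ {a b} → a ≡ 0ℤ → Unit± b → Unit± (a ℤ.+ b)
zero+unit {b = b} refl ub = subst Unit± (sym (ℤ.+-identityˡ b)) ub

shift : ℤ → ℤ → V → V
shift a b (i , j) = i ℤ.+ a , j ℤ.+ b

shift-zero : ∀ u → shift 0ℤ 0ℤ u ≡ u
shift-zero (i , j) = cong₂ _,_ (ℤ.+-identityʳ i) (ℤ.+-identityʳ j)

shift-of-diff : ∀ u w {a b} → proj₁ u ℤ.- proj₁ w ≡ a → proj₂ u ℤ.- proj₂ w ≡ b →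
                w ≡ shift (ℤ.- a) (ℤ.- b) u
shift-of-diff (i , j) (i′ , j′) e f = cong₂ _,_ (solve-diff i i′ e) (solve-diff j j′ f)

shiftMove : ∀ {a b} → Small a → Small b → Move
shiftMove {a} {b} sa sb = record
  { to           = shift a b
  ; from         = shift (ℤ.- a) (ℤ.- b)
  ; to-from      = λ (i , j) → cong₂ _,_ (−-+-cancel i a) (−-+-cancel j b)
  ; to-expands   = expands (widens-+ sa) (λ _ → widens-+ sb)
  ; from-expands = expands (widens-+ (Small-neg sa)) (λ _ → widens-+ (Small-neg sb))
  }

small₀ : Small 0ℤ
small₀ = inj₁ refl

small₊₁ : Small 1ℤ
small₊₁ = inj₂ (inj₁ refl)

small₋₁ : Small -1ℤ
small₋₁ = inj₂ (inj₂ refl)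

sqMoves : List Move
sqMoves = shiftMove small₀ small₀ ∷ shiftMove small₊₁ small₀ ∷ shiftMove small₋₁ small₀
        ∷ shiftMove small₀ small₊₁ ∷ shiftMove small₀ small₋₁ ∷ []

sq-describes : Describes SqAdj sqMoves
sq-describes = record { closed-neighbourhood = λ u w → mk⇔ (to′ u w) (from′ u w) }
  where
  to′ : ∀ u w → (N[ SqAdj ]∋ u) w → w ∈ neighbours sqMoves u
  to′ u _ (inj₁ refl)                = here (sym (shift-zero u))
  to′ u w (inj₂ (inj₁ (inj₁ e , f))) = there (there (here (shift-of-diff u w e f)))
  to′ u w (inj₂ (inj₁ (inj₂ e , f))) = there (here (shift-of-diff u w e f))
  to′ u w (inj₂ (inj₂ (e , inj₁ f))) = there (there (there (there (here (shift-of-diff u w e f)))))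
  to′ u w (inj₂ (inj₂ (e , inj₂ f))) = there (there (there (here (shift-of-diff u w e f))))

  from′ : ∀ u w → w ∈ neighbours sqMoves u → (N[ SqAdj ]∋ u) w
  from′ u _ (here refl) = inj₁ (shift-zero u)
  from′ (i , j) _ (there (here refl)) =
    inj₂ (inj₁ (inj₂ (diff-shift i 1ℤ) , diff-shift j 0ℤ))
  from′ (i , j) _ (there (there (here refl))) =
    inj₂ (inj₁ (inj₁ (diff-shift i -1ℤ) , diff-shift j 0ℤ))
  from′ (i , j) _ (there (there (there (here refl)))) =
    inj₂ (inj₂ (diff-shift i 0ℤ , inj₂ (diff-shift j 1ℤ)))
  from′ (i , j) _ (there (there (there (there (here refl))))) =
    inj₂ (inj₂ (diff-shift i 0ℤ , inj₁ (diff-shift j -1ℤ)))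

sq-bipartite : Bipartite SqAdj
sq-bipartite _ _ (inj₁ (ua , f)) = unit+zero ua f
sq-bipartite _ _ (inj₂ (e , ub)) = zero+unit e ub

paritySign : ℕ → ℤ
paritySign zero    = -1ℤ
paritySign (suc _) = 1ℤ

paritySign-unit : ∀ k → Unit± (paritySign k)
paritySign-unit zero    = inj₂ refl
paritySign-unit (suc _) = inj₁ refl

paritySign-suc : ∀ n → paritySign (suc n % 2) ≡ ℤ.- paritySign (n % 2)
paritySign-suc zero    = refl
paritySign-suc (suc n) = begin
  paritySign (suc (suc n) % 2)  ≡⟨ cong paritySign (trans (cong (_% 2) (ℕ.+-comm 2 n)) ([m+n]%n≡m%n n 2)) ⟩
  paritySign (n % 2)            ≡⟨ ℤ.neg-involutive _ ⟨
  ℤ.- ℤ.- paritySign (n % 2)    ≡⟨ cong ℤ.-_ (paritySign-suc n) ⟨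
  ℤ.- paritySign (suc n % 2)    ∎
  where open ≡-Reasoning

paritySign-alternates : ∀ x → paritySign (∣ x ℤ.+ 1ℤ ∣ % 2) ≡ ℤ.- paritySign (∣ x ∣ % 2)
paritySign-alternates (+ n) rewrite ℕ.+-comm n 1 = paritySign-suc n
paritySign-alternates -[1+ zero ]  = refl
paritySign-alternates -[1+ suc n ] =
  sym (trans (cong ℤ.-_ (paritySign-suc (suc n))) (ℤ.neg-involutive _))

hexSign≡paritySign : ∀ i j → hexSign i j ≡ paritySign (∣ i ℤ.+ j ∣ % 2)
hexSign≡paritySign i j with ∣ i ℤ.+ j ∣ % 2
... | zero  = refl
... | suc _ = refl

hexSign-unit : ∀ i j → Unit± (hexSign i j)
hexSign-unit i j = subst Unit± (sym (hexSign≡paritySign i j)) (paritySign-unit _)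

hexSign-alternates : ∀ i j → hexSign i (j ℤ.+ 1ℤ) ≡ ℤ.- hexSign i j
hexSign-alternates i j = begin
  hexSign i (j ℤ.+ 1ℤ)                   ≡⟨ hexSign≡paritySign i (j ℤ.+ 1ℤ) ⟩
  paritySign (∣ i ℤ.+ (j ℤ.+ 1ℤ) ∣ % 2)  ≡⟨ cong (λ x → paritySign (∣ x ∣ % 2)) (ℤ.+-assoc i j 1ℤ) ⟨
  paritySign (∣ (i ℤ.+ j) ℤ.+ 1ℤ ∣ % 2)  ≡⟨ paritySign-alternates (i ℤ.+ j) ⟩
  ℤ.- paritySign (∣ i ℤ.+ j ∣ % 2)       ≡⟨ cong ℤ.-_ (hexSign≡paritySign i j) ⟨
  ℤ.- hexSign i j                        ∎
  where open ≡-Reasoning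

module HexColumn (i : ℤ) = Partner (hexSign i) (hexSign-unit i) (hexSign-alternates i)

hexFlip : V → V
hexFlip (i , j) = i , HexColumn.partner i j

hexFlipMove : Move
hexFlipMove = record
  { to           = hexFlip
  ; from         = hexFlip
  ; to-from      = λ (i , j) → cong (i ,_) (HexColumn.partner-involutive i j)
  ; to-expands   = expands widens-id HexColumn.widens-partner
  ; from-expands = expands widens-id HexColumn.widens-partner
  }

hexMoves : List Move
hexMoves = shiftMove small₀ small₀ ∷ shiftMove small₊₁ small₀ ∷ shiftMove small₋₁ small₀
         ∷ hexFlipMove ∷ []

hex-describes : Describes HexAdj hexMoves
hex-describes = record { closed-neighbourhood = λ u w → mk⇔ (to′ u w) (from′ u w) }
  where
  to′ : ∀ u w → (N[ HexAdj ]∋ u) w → w ∈ neighbours hexMoves u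
  to′ u _ (inj₁ refl)                = here (sym (shift-zero u))
  to′ u w (inj₂ (inj₁ (inj₁ e , f))) = there (there (here (shift-of-diff u w e f)))
  to′ u w (inj₂ (inj₁ (inj₂ e , f))) = there (here (shift-of-diff u w e f))
  to′ (i , j) (i′ , j′) (inj₂ (inj₂ (e , f))) = there (there (there (here
    (cong₂ _,_ (trans (solve-diff i i′ e) (ℤ.+-identityʳ i)) (solve-diff j j′ f)))))

  from′ : ∀ u w → w ∈ neighbours hexMoves u → (N[ HexAdj ]∋ u) w
  from′ u _ (here refl) = inj₁ (shift-zero u)
  from′ (i , j) _ (there (here refl)) =
    inj₂ (inj₁ (inj₂ (diff-shift i 1ℤ) , diff-shift j 0ℤ))
  from′ (i , j) _ (there (there (here refl))) =
    inj₂ (inj₁ (inj₁ (diff-shift i -1ℤ) , diff-shift j 0ℤ))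
  from′ (i , j) _ (there (there (there (here refl)))) =
    inj₂ (inj₂ (ℤ.+-inverseʳ i , −-−-cancel j (hexSign i j)))

hex-bipartite : Bipartite HexAdj
hex-bipartite _ _ (inj₁ (ua , f)) = unit+zero ua f
hex-bipartite (i , j) _ (inj₂ (e , f)) = zero+unit e (subst Unit± (sym f) (hexSign-unit i j))

-- Perfect linear codes

rotate : ∀ {m} → Fin (suc m) → Fin (suc m)
rotate {m} i = suc (toℕ i) mod suc m

rotate⁻¹ : ∀ {m} → Fin (suc m) → Fin (suc m)
rotate⁻¹ {m} i = (toℕ i + m) mod suc m

%-absorbʳ : ∀ a b d .{{_ : ℕ.NonZero d}} → (a + b % d) % d ≡ (a + b) % d
%-absorbʳ a b d = begin
  (a + b % d) % d           ≡⟨ %-distribˡ-+ a (b % d) d ⟩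
  (a % d + b % d % d) % d   ≡⟨ cong (λ k → (a % d + k) % d) (m%n%n≡m%n b d) ⟩
  (a % d + b % d) % d       ≡⟨ %-distribˡ-+ a b d ⟨
  (a + b) % d               ∎
  where open ≡-Reasoning

%-absorbˡ : ∀ a b d .{{_ : ℕ.NonZero d}} → (a % d + b) % d ≡ (a + b) % d
%-absorbˡ a b d = begin
  (a % d + b) % d   ≡⟨ cong (_% d) (ℕ.+-comm (a % d) b) ⟩
  (b + a % d) % d   ≡⟨ %-absorbʳ b a d ⟩
  (b + a) % d       ≡⟨ cong (_% d) (ℕ.+-comm b a) ⟩
  (a + b) % d       ∎
  where open ≡-Reasoning

toℕ-rotate : ∀ {m} (i : Fin (suc m)) → toℕ (rotate i) ≡ suc (toℕ i) % suc m
toℕ-rotate i = toℕ-fromℕ< _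

toℕ-rotate⁻¹ : ∀ {m} (i : Fin (suc m)) → toℕ (rotate⁻¹ i) ≡ (toℕ i + m) % suc m
toℕ-rotate⁻¹ i = toℕ-fromℕ< _

private
  +-mod-self : ∀ {m} (i : Fin (suc m)) → (toℕ i + suc m) % suc m ≡ toℕ i
  +-mod-self {m} i = trans ([m+n]%n≡m%n (toℕ i) (suc m)) (m<n⇒m%n≡m (toℕ<n i))

rotate-rotate⁻¹ : ∀ {m} (i : Fin (suc m)) → rotate (rotate⁻¹ i) ≡ i
rotate-rotate⁻¹ {m} i = toℕ-injective (begin
  toℕ (rotate (rotate⁻¹ i))          ≡⟨ toℕ-rotate (rotate⁻¹ i) ⟩
  suc (toℕ (rotate⁻¹ i)) % suc m     ≡⟨ cong (λ k → suc k % suc m) (toℕ-rotate⁻¹ i) ⟩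
  (1 + (toℕ i + m) % suc m) % suc m  ≡⟨ %-absorbʳ 1 (toℕ i + m) (suc m) ⟩
  suc (toℕ i + m) % suc m            ≡⟨ cong (_% suc m) (ℕ.+-suc (toℕ i) m) ⟨
  (toℕ i + suc m) % suc m            ≡⟨ +-mod-self i ⟩
  toℕ i                              ∎)
  where open ≡-Reasoning

rotate⁻¹-rotate : ∀ {m} (i : Fin (suc m)) → rotate⁻¹ (rotate i) ≡ i
rotate⁻¹-rotate {m} i = toℕ-injective (begin
  toℕ (rotate⁻¹ (rotate i))          ≡⟨ toℕ-rotate⁻¹ (rotate i) ⟩
  (toℕ (rotate i) + m) % suc m       ≡⟨ cong (λ k → (k + m) % suc m) (toℕ-rotate i) ⟩
  (suc (toℕ i) % suc m + m) % suc m  ≡⟨ %-absorbˡ (suc (toℕ i)) m (suc m) ⟩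
  suc (toℕ i + m) % suc m            ≡⟨ cong (_% suc m) (ℕ.+-suc (toℕ i) m) ⟨
  (toℕ i + suc m) % suc m            ≡⟨ +-mod-self i ⟩
  toℕ i                              ∎)
  where open ≡-Reasoning

module ℤ-Action {A : Set} (next prev : A → A)
                (next-prev : ∀ a → next (prev a) ≡ a) (prev-next : ∀ a → prev (next a) ≡ a) where

  act : ℤ → A → A
  act (+ zero)     a = a
  act (+ suc n)    a = next (act (+ n) a)
  act -[1+ zero ]  a = prev a
  act -[1+ suc n ] a = prev (act -[1+ n ] a)

  act-suc : ∀ x a → act (x ℤ.+ 1ℤ) a ≡ next (act x a)
  act-suc (+ n)         a rewrite ℕ.+-comm n 1 = refl
  act-suc -[1+ zero ]   a = sym (next-prev a)
  act-suc -[1+ suc n ]  a = sym (next-prev _)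

  act-pred : ∀ x a → act (x ℤ.- 1ℤ) a ≡ prev (act x a)
  act-pred x a = begin
    act (x ℤ.- 1ℤ) a                     ≡⟨ prev-next _ ⟨
    prev (next (act (x ℤ.- 1ℤ) a))       ≡⟨ cong prev (act-suc (x ℤ.- 1ℤ) a) ⟨
    prev (act ((x ℤ.- 1ℤ) ℤ.+ 1ℤ) a)     ≡⟨ cong (λ y → prev (act y a)) (−-+-cancel x 1ℤ) ⟩
    prev (act x a)                       ∎
    where open ≡-Reasoning

  act-+ : ∀ x y a → act (x ℤ.+ y) a ≡ act y (act x a)
  act-+ x (+ zero)     a = cong (λ z → act z a) (ℤ.+-identityʳ x)
  act-+ x (+ suc n)    a = begin
    act (x ℤ.+ + suc n) a               ≡⟨ cong (λ z → act z a) (x+[y+1] x (+ n) +suc) ⟩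
    act ((x ℤ.+ + n) ℤ.+ 1ℤ) a          ≡⟨ act-suc (x ℤ.+ + n) a ⟩
    next (act (x ℤ.+ + n) a)            ≡⟨ cong next (act-+ x (+ n) a) ⟩
    next (act (+ n) (act x a))          ∎
    where
    open ≡-Reasoning
    +suc : + suc n ≡ + n ℤ.+ 1ℤ
    +suc = trans (cong +_ (ℕ.+-comm 1 n)) (ℤ.pos-+ n 1)
    x+[y+1] : ∀ x y {z} → z ≡ y ℤ.+ 1ℤ → x ℤ.+ z ≡ (x ℤ.+ y) ℤ.+ 1ℤ
    x+[y+1] x y refl = sym (ℤ.+-assoc x y 1ℤ)
  act-+ x -[1+ zero ]  a = act-pred x a
  act-+ x -[1+ suc n ] a = begin
    act (x ℤ.+ -[1+ suc n ]) a              ≡⟨ cong (λ z → act z a) x+[y-1] ⟩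
    act ((x ℤ.+ -[1+ n ]) ℤ.- 1ℤ) a         ≡⟨ act-pred (x ℤ.+ -[1+ n ]) a ⟩
    prev (act (x ℤ.+ -[1+ n ]) a)           ≡⟨ cong prev (act-+ x -[1+ n ] a) ⟩
    prev (act -[1+ n ] (act x a))           ∎
    where
    open ≡-Reasoning
    x+[y-1] : x ℤ.+ -[1+ suc n ] ≡ (x ℤ.+ -[1+ n ]) ℤ.- 1ℤ
    x+[y-1] = trans (cong (λ k → x ℤ.+ -[1+ suc k ]) (sym (ℕ.+-identityʳ n)))
                    (sym (ℤ.+-assoc x -[1+ n ] -1ℤ))

module Rotation (m : ℕ) = ℤ-Action (rotate {m}) rotate⁻¹ rotate-rotate⁻¹ rotate⁻¹-rotate

residue : ∀ m → ℤ → Fin (suc m)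
residue m x = Rotation.act m x zero

residue-+ : ∀ m x c → residue m (x ℤ.+ c) ≡ Rotation.act m c (residue m x)
residue-+ m x c = Rotation.act-+ m x c zero

isZero : ∀ {n} → Fin n → Bool
isZero zero    = true
isZero (suc _) = false

L : V → ℤ
L (i , j) = i ℤ.+ + 2 ℤ.* j

-- The code {(i , j) : i + 2j ≡ 0 (mod m + 1)}.
linearCode : ℕ → Code
linearCode m u = isZero (residue m (L u))

zeroCount : ∀ m → List ℤ → Fin (suc m) → ℕ
zeroCount m cs r = sum (map (λ c → b2n (isZero (Rotation.act m c r))) cs)

residue-shift : ∀ m a b u →
                residue m (L (shift a b u)) ≡ Rotation.act m (a ℤ.+ + 2 ℤ.* b) (residue m (L u))
residue-shift m a b (i , j) = trans (cong (residue m) (L-shift i j a b)) (residue-+ m (L (i , j)) _)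
  where
  L-shift : ∀ i j a b →
            (i ℤ.+ a) ℤ.+ + 2 ℤ.* (j ℤ.+ b) ≡ (i ℤ.+ + 2 ℤ.* j) ℤ.+ (a ℤ.+ + 2 ℤ.* b)
  L-shift = ℤ-Ring.solve-∀

sqCode : Code
sqCode = linearCode 4

-- 0, ±1, ±2 is a complete residue system modulo 5.
sqCode-perfect : ∀ u → hits sqCode sqMoves u ≡ 1
sqCode-perfect u = trans (cong₂ _+_ (hit 0ℤ 0ℤ) (cong₂ _+_ (hit 1ℤ 0ℤ) (cong₂ _+_ (hit -1ℤ 0ℤ)
                           (cong₂ _+_ (hit 0ℤ 1ℤ) (cong₂ _+_ (hit 0ℤ -1ℤ) refl)))))
                         (complete (residue 4 (L u)))
  where
  hit : ∀ a b → b2n (sqCode (shift a b u)) ≡ b2n (isZero (Rotation.act 4 (a ℤ.+ + 2 ℤ.* b) _))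
  hit a b = cong (b2n ∘ isZero) (residue-shift 4 a b u)
  offsets : List ℤ
  offsets = 0ℤ ∷ 1ℤ ∷ -1ℤ ∷ + 2 ∷ -[1+ 1 ] ∷ []
  complete : ∀ r → zeroCount 4 offsets r ≡ 1
  complete = from-yes (all? λ r → zeroCount 4 offsets r ℕ.≟ 1)

hexCode : Code
hexCode = linearCode 3

-- hexFlip moves i + 2j by ±2, and 2 ≡ -2 modulo 4.
residue-hexFlip : ∀ u → residue 3 (L (hexFlip u)) ≡ Rotation.act 3 (+ 2) (residue 3 (L u))
residue-hexFlip u@(i , j) = trans (cong (residue 3) (L-flip i j (hexSign i j))) (by-sign (hexSign-unit i j))
  where
  L-flip : ∀ i j h → i ℤ.+ + 2 ℤ.* (j ℤ.- h) ≡ (i ℤ.+ + 2 ℤ.* j) ℤ.+ ℤ.- (+ 2 ℤ.* h)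
  L-flip = ℤ-Ring.solve-∀
  two≡-two : ∀ r → Rotation.act 3 -[1+ 1 ] r ≡ Rotation.act 3 (+ 2) r
  two≡-two = from-yes (all? λ r → Rotation.act 3 -[1+ 1 ] r Fin.≟ Rotation.act 3 (+ 2) r)
  by-sign : ∀ {h} → Unit± h → residue 3 (L u ℤ.+ ℤ.- (+ 2 ℤ.* h)) ≡ Rotation.act 3 (+ 2) (residue 3 (L u))
  by-sign (inj₁ refl) = trans (residue-+ 3 (L u) -[1+ 1 ]) (two≡-two (residue 3 (L u)))
  by-sign (inj₂ refl) = residue-+ 3 (L u) (+ 2)

-- 0, ±1, 2 is a complete residue system modulo 4.
hexCode-perfect : ∀ u → hits hexCode hexMoves u ≡ 1
hexCode-perfect u = trans (cong₂ _+_ (hit 0ℤ 0ℤ) (cong₂ _+_ (hit 1ℤ 0ℤ) (cong₂ _+_ (hit -1ℤ 0ℤ)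
                            (cong₂ _+_ (cong (b2n ∘ isZero) (residue-hexFlip u)) refl))))
                          (complete (residue 3 (L u)))
  where
  hit : ∀ a b → b2n (hexCode (shift a b u)) ≡ b2n (isZero (Rotation.act 3 (a ℤ.+ + 2 ℤ.* b) _))
  hit a b = cong (b2n ∘ isZero) (residue-shift 3 a b u)
  offsets : List ℤ
  offsets = 0ℤ ∷ 1ℤ ∷ -1ℤ ∷ + 2 ∷ []
  complete : ∀ r → zeroCount 3 offsets r ≡ 1
  complete = from-yes (all? λ r → zeroCount 3 offsets r ℕ.≟ 1)

-- From counting bounds to densities

boxSize-suc : ∀ n → boxSize (suc n) ≡ boxSize n + 8 * suc n
boxSize-suc = expand
  where
  expand : ∀ n → suc (2 * suc n) * suc (2 * suc n) ≡ suc (2 * n) * suc (2 * n) + 8 * suc n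
  expand = ℕ-Ring.solve-∀

layer≤boxSize : ∀ n D → 4 * D ≤ n → 8 * suc n * D ≤ boxSize n
layer≤boxSize n D 4D≤n = begin
  8 * suc n * D                        ≡⟨ regroup n D ⟩
  2 * suc n * (4 * D)                  ≤⟨ ℕ.*-monoʳ-≤ (2 * suc n) 4D≤n ⟩
  2 * suc n * n                        ≤⟨ ℕ.m≤m+n (2 * suc n * n) (suc (2 * suc n * n)) ⟩
  2 * suc n * n + suc (2 * suc n * n)  ≡⟨ expand n ⟨
  boxSize n                            ∎
  where
  open ℕ.≤-Reasoning
  regroup : ∀ n D → 8 * suc n * D ≡ 2 * suc n * (4 * D)
  regroup = ℕ-Ring.solve-∀
  expand : ∀ n → suc (2 * n) * suc (2 * n) ≡ 2 * suc n * n + suc (2 * suc n * n)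
  expand = ℕ-Ring.solve-∀

upper-core : ∀ n k p c D → 4 * D ≤ n → suc k * c ≤ boxSize (suc n) →
             c * (suc k * D) ≤ (D + suc p * suc k) * boxSize n
upper-core n k p c D 4D≤n Kc≤ = begin
  c * (K * D)                             ≡⟨ regroup c K D ⟩
  K * c * D                               ≤⟨ ℕ.*-monoˡ-≤ D Kc≤ ⟩
  boxSize (suc n) * D                     ≡⟨ cong (_* D) (boxSize-suc n) ⟩
  (W + 8 * suc n) * D                     ≡⟨ ℕ.*-distribʳ-+ D W (8 * suc n) ⟩
  W * D + 8 * suc n * D                   ≤⟨ ℕ.+-monoʳ-≤ (W * D) (layer≤boxSize n D 4D≤n) ⟩
  W * D + W                               ≤⟨ ℕ.+-monoʳ-≤ (W * D) (ℕ.m≤n*m W (suc p * K)) ⟩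
  W * D + suc p * K * W                   ≡⟨ collect W D (suc p * K) ⟩
  (D + suc p * K) * W                     ∎
  where
  open ℕ.≤-Reasoning
  K = suc k
  W = boxSize n
  regroup : ∀ c K D → c * (K * D) ≡ K * c * D
  regroup = ℕ-Ring.solve-∀
  collect : ∀ W D Q → W * D + Q * W ≡ (D + Q) * W
  collect = ℕ-Ring.solve-∀

lower-core : ∀ n k p c D → 4 * D ≤ n → boxSize n ≤ suc k * c →
             D * boxSize (suc n) < c * (suc k * D) + suc p * suc k * boxSize (suc n)
lower-core n k p c D 4D≤n W≤Kc = begin-strict
  D * W′                                  ≡⟨ cong (D *_) (boxSize-suc n) ⟩
  D * (W + 8 * suc n)                     ≡⟨ ℕ.*-distribˡ-+ D W (8 * suc n) ⟩
  D * W + D * (8 * suc n)                 <⟨ ℕ.+-mono-≤-< (ℕ.*-monoʳ-≤ D W≤Kc) layer< ⟩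
  D * (K * c) + suc p * K * W′            ≡⟨ cong (_+ suc p * K * W′) (regroup D K c) ⟩
  c * (K * D) + suc p * K * W′            ∎
  where
  open ℕ.≤-Reasoning
  K = suc k
  W = boxSize n
  W′ = boxSize (suc n)
  regroup : ∀ D K c → D * (K * c) ≡ c * (K * D)
  regroup = ℕ-Ring.solve-∀
  layer< : D * (8 * suc n) < suc p * K * W′
  layer< = begin-strict
    D * (8 * suc n)     ≡⟨ ℕ.*-comm D (8 * suc n) ⟩
    8 * suc n * D       ≤⟨ layer≤boxSize n D 4D≤n ⟩
    W                   <⟨ ℕ.m<m+n W (s≤s z≤n) ⟩
    W + 8 * suc n       ≡⟨ boxSize-suc n ⟨
    W′                  ≤⟨ ℕ.m≤n*m W′ (suc p * K) ⟩
    suc p * K * W′      ∎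

ratio≃ : ∀ C n → toℚᵘ (ratio C n) ≃ᵘ mkℚᵘ (+ count C n) (ℕ.pred (boxSize n))
ratio≃ C n = toℚᵘ-fromℚᵘ (mkℚᵘ (+ count C n) (ℕ.pred (boxSize n)))

toℚᵘ-1/k+ : ∀ k q → toℚᵘ ((+ 1) / suc k ℚ.+ q) ≃ᵘ mkℚᵘ 1ℤ k ℚᵘ.+ toℚᵘ q
toℚᵘ-1/k+ k q =
  ℚᵘ.≃-trans (toℚᵘ-homo-+ ((+ 1) / suc k) q) (ℚᵘ.+-congˡ (toℚᵘ q) (toℚᵘ-fromℚᵘ (mkℚᵘ 1ℤ k)))

sum-numerator≡ : ∀ D P K W → (1ℤ ℤ.* + D ℤ.+ + P ℤ.* + K) ℤ.* + W ≡ + ((D + P * K) * W)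
sum-numerator≡ D P K W = begin
  (1ℤ ℤ.* + D ℤ.+ + P ℤ.* + K) ℤ.* + W   ≡⟨ drop-1* (+ D) (+ P) (+ K) (+ W) ⟩
  (+ D ℤ.+ + P ℤ.* + K) ℤ.* + W          ≡⟨ cong (λ x → (+ D ℤ.+ x) ℤ.* + W) (ℤ.pos-* P K) ⟨
  (+ D ℤ.+ + (P * K)) ℤ.* + W            ≡⟨ cong (ℤ._* + W) (ℤ.pos-+ D (P * K)) ⟨
  + (D + P * K) ℤ.* + W                  ≡⟨ ℤ.pos-* (D + P * K) W ⟨
  + ((D + P * K) * W)                    ∎
  where
  open ≡-Reasoning
  drop-1* : ∀ d q k w → (1ℤ ℤ.* d ℤ.+ q ℤ.* k) ℤ.* w ≡ (d ℤ.+ q ℤ.* k) ℤ.* w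
  drop-1* = ℤ-Ring.solve-∀

difference-numerator≡ : ∀ D P K W →
                        (1ℤ ℤ.* + D ℤ.+ ℤ.- (+ P) ℤ.* + K) ℤ.* + W ≡ + (D * W) ℤ.- + (P * K * W)
difference-numerator≡ D P K W = begin
  (1ℤ ℤ.* + D ℤ.+ ℤ.- (+ P) ℤ.* + K) ℤ.* + W   ≡⟨ distribute (+ D) (+ P) (+ K) (+ W) ⟩
  + D ℤ.* + W ℤ.- + P ℤ.* + K ℤ.* + W          ≡⟨ cong₂ ℤ._-_ (ℤ.pos-* D W) PKW ⟨
  + (D * W) ℤ.- + (P * K * W)                  ∎
  where
  open ≡-Reasoning
  distribute : ∀ d q k w → (1ℤ ℤ.* d ℤ.+ ℤ.- q ℤ.* k) ℤ.* w ≡ d ℤ.* w ℤ.- q ℤ.* k ℤ.* w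
  distribute = ℤ-Ring.solve-∀
  PKW : + (P * K * W) ≡ + P ℤ.* + K ℤ.* + W
  PKW = trans (ℤ.pos-* (P * K) W) (cong (ℤ._* + W) (ℤ.pos-* P K))

sub<⇒<+ : ∀ {x y z} → x < z + y → + x ℤ.- + y ℤ.< + z
sub<⇒<+ {x} {y} {z} x<z+y = subst (+ x ℤ.- + y ℤ.<_) (+-−-cancel (+ z) (+ y))
  (ℤ.+-monoˡ-< (ℤ.- + y) (subst (+ x ℤ.<_) (ℤ.pos-+ z y) (ℤ.+<+ x<z+y)))

below-1/k+p/d : ∀ k p d c w → c * (suc k * suc d) ≤ (suc d + suc p * suc k) * suc w →
                mkℚᵘ (+ c) w ≤ᵘ mkℚᵘ 1ℤ k ℚᵘ.+ mkℚᵘ +[1+ p ] d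
below-1/k+p/d k p d c w h =
  ℚᵘ.*≤* (subst₂ ℤ._≤_ (ℤ.pos-* c _) (sym (sum-numerator≡ (suc d) (suc p) (suc k) (suc w)))
                       (ℤ.+≤+ h))

above-1/k-p/d : ∀ k p d c w → suc d * suc w < c * (suc k * suc d) + suc p * suc k * suc w →
                mkℚᵘ 1ℤ k ℚᵘ.+ mkℚᵘ -[1+ p ] d <ᵘ mkℚᵘ (+ c) w
above-1/k-p/d k p d c w h =
  ℚᵘ.*<* (subst₂ ℤ._<_ (sym (difference-numerator≡ (suc d) (suc p) (suc k) (suc w))) (ℤ.pos-* c _)
                       (sub<⇒<+ h))

-- With ε = P/D, from n ≥ 4D on the layer Q_{n+1} ∖ Q_n has at most |Q_n|/D points.
ratio-limsup≤ : ∀ k C → (∀ n → suc k * count C n ≤ boxSize (suc n)) →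
                LimsupLe (ratio C) ((+ 1) / suc k)
ratio-limsup≤ k C bound ε@(mkℚ +[1+ p ] d _) _ = 4 * suc d , λ n 4D≤n →
  toℚᵘ-cancel-≤ (ℚᵘ.≤-respˡ-≃ (ℚᵘ.≃-sym (ratio≃ C n))
    (ℚᵘ.≤-respʳ-≃ (ℚᵘ.≃-sym (toℚᵘ-1/k+ k ε))
      (below-1/k+p/d k p d (count C n) _ (upper-core n k p (count C n) (suc d) 4D≤n (bound n)))))
ratio-limsup≤ k C bound (mkℚ +0 _ _)       (ℚ.*<* (ℤ.+<+ ()))
ratio-limsup≤ k C bound (mkℚ -[1+ _ ] _ _) (ℚ.*<* ())

ratio-limsup≥ : ∀ k C → (∀ n → boxSize n ≤ suc k * count C (suc n)) →
                LimsupGe (ratio C) ((+ 1) / suc k)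
ratio-limsup≥ k C bound ε@(mkℚ +[1+ p ] d _) _ N = suc n , N≤1+n ,
  toℚᵘ-cancel-< (ℚᵘ.<-respʳ-≃ (ℚᵘ.≃-sym (ratio≃ C (suc n)))
    (ℚᵘ.<-respˡ-≃ (ℚᵘ.≃-sym (toℚᵘ-1/k+ k (ℚ.- ε)))
      (above-1/k-p/d k p d c _ (lower-core n k p c (suc d) (ℕ.m≤n+m (4 * suc d) N) (bound n)))))
  where
  n = N + 4 * suc d
  c = count C (suc n)
  N≤1+n : N ≤ suc n
  N≤1+n = ℕ.≤-trans (ℕ.m≤m+n N (4 * suc d)) (ℕ.n≤1+n n)
ratio-limsup≥ k C bound (mkℚ +0 _ _)       (ℚ.*<* (ℤ.+<+ ())) N
ratio-limsup≥ k C bound (mkℚ -[1+ _ ] _ _) (ℚ.*<* ()) N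

perfect-code⇒GammaLLD≡ : ∀ {G m ms} (C : Code) → Describes G (m ∷ ms) → Bipartite G →
                         (∀ u → hits C (m ∷ ms) u ≡ 1) → GammaLLD≡ G ((+ 1) / length (m ∷ ms))
perfect-code⇒GammaLLD≡ {G} {m} {ms} C G≅ms bip perfect =
    ( C
    , bipartite-covering⇒LLD bip C-covers
    , ratio-limsup≤ (length ms) C (perfect-bound C (m ∷ ms) perfect)
    , lower C C-covers )
  , λ C′ lld → lower C′ (proj₁ lld)
  where
  C-covers : IsCovering G C
  C-covers = hits⇒covering G≅ms C (λ u → ℕ.≤-reflexive (sym (perfect u)))
  lower : ∀ C′ → IsCovering G C′ → DensityGe C′ ((+ 1) / length (m ∷ ms))
  lower C′ cov =
    ratio-limsup≥ (length ms) C′ (covering-bound C′ (m ∷ ms) (covering⇒hits G≅ms C′ cov))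

mainTheorem14 : GammaLLD≡ SqAdj ((+ 1) / 5) × GammaLLD≡ HexAdj ((+ 1) / 4)
mainTheorem14 = perfect-code⇒GammaLLD≡ sqCode sq-describes sq-bipartite sqCode-perfect
              , perfect-code⇒GammaLLD≡ hexCode hex-describes hex-bipartite hexCode-perfect
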